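{- For all integers $k$ and $n$ with $k\geq 2$ and $n\geq 2k+1$, there exists a $k$-latin square of order $n$ which is not fully separable.
   Context: For a positive integer $a$, $N(a)=\{1,\dots,a\}$. A $k$-latin square of order $n$ is an $n\times n$ array whose cell $(i,j)$ contains a multiset of exactly $k$ elements of $N(n)$, such that each symbol of $N(n)$ occurs exactly $k$ times (counting multiplicity) in each row and in each column; a $1$-latin square is a latin square. The join of $L_1$ and $L_2$ (of the same order) is the array with cells $L_1(i,j)\cup L_2(i,j)$ (multiset union). A $k$-latin square is fully separable if it is the join of $k$ latin squares. -}

module Defs where

open import Data.Nat using (ℕ; zero; suc; _+_)
open import Data.Fin using (Fin; zero; suc)
open import Data.Product using (Σ; _×_)
open import Relation.Binary.PropositionalEquality using (_≡_)

sumFin : {n : ℕ} → (Fin n → ℕ) → ℕ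
sumFin {zero}  f = 0
sumFin {suc n} f = f zero + sumFin (λ i → f (suc i))

-- A multiset of elements of N(n) = Fin n, given by its multiplicity function.
Multiset : ℕ → Set
Multiset n = Fin n → ℕ

Array : ℕ → Set
Array n = Fin n → Fin n → Multiset n

record IsKLatin (k n : ℕ) (A : Array n) : Set where
  field
    cellSize : ∀ i j → sumFin (λ s → A i j s) ≡ k
    rowCount : ∀ i s → sumFin (λ j → A i j s) ≡ k
    colCount : ∀ j s → sumFin (λ i → A i j s) ≡ k

IsLatin : (n : ℕ) → Array n → Set
IsLatin n A = IsKLatin 1 n A

join : {n : ℕ} → Array n → Array n → Array n
join A B i j s = A i j s + B i j s

joinAll : {n : ℕ} (k : ℕ) → (Fin k → Array n) → Array n
joinAll zero    Ls i j s = 0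
joinAll (suc k) Ls = join (Ls zero) (joinAll k (λ t → Ls (suc t)))

FullySeparable : (k n : ℕ) → Array n → Set
FullySeparable k n A =
  Σ (Fin k → Array n) λ Ls →
    (∀ t → IsLatin n (Ls t)) × (∀ i j s → A i j s ≡ joinAll k Ls i j s)

module Submission where

-- For k ≥ 2 and n ≥ 4 we build a k-latin square of order n that is not
-- fully separable; the theorem follows since n ≥ 2k + 1 ≥ 5.
--
-- Let cyc c be the cyclic latin square with symbol
-- c + i + j (mod n) in cell (i, j).  The 2-latin square T agrees with
-- cyc 0 ∪ cyc 1 outside rows 1 and 2; row 1 comes from cyc 0 ∪ cyc 2 and row
-- 2 from cyc 0 ∪ cyc 0, with the symbols of columns 1 and 2 redistributed so
-- that every column of T keeps the contents of cyc 0 ∪ cyc 1.  The square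
-- A = T ∪ (k - 2) copies of cyc 0 is k-latin, since joins add parameters.
--
-- Obstruction (a "trap").  Let r ≠ r', c ≠ c' and let the cells (r, c'),
-- (r, c), (r', c) of A contain only symbols from {σ, τ}, {τ, ρ}, {ρ, σ}.  A
-- latin square inside A with σ at (r', c') is forced, along column c', row r
-- and column c, to have σ at (r', c) too, contradicting row r'.  But some
-- latin component of a decomposition of A has σ at (r', c'), and every
-- component lies inside A.  In A a trap is r = 1, r' = 0, c = 1, c' = 0,
-- σ = 1, τ = 3, ρ = 2.

open import Defs
open import Data.Nat using (ℕ; zero; suc; _+_; _*_; _%_; _≤_; _<_; z≤n; s≤s; s≤s⁻¹; NonZero)
open import Data.Nat.Properties
open import Data.Nat.DivMod using (m<n⇒m%n≡m; [m+n]%n≡m%n; m%n<n)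
open import Data.Fin using (Fin; zero; suc; toℕ; fromℕ; fromℕ<; inject₁; punchOut)
open import Data.Fin.Patterns using (0F; 1F; 2F; 3F)
open import Data.Fin.Properties using (toℕ-injective; toℕ-fromℕ; toℕ-fromℕ<; toℕ-inject₁; toℕ<n; punchIn-punchOut; punchInᵢ≢i)
import Data.Fin.Properties as Fin
open import Data.Vec.Functional using (removeAt)
open import Data.Product using (Σ; _,_; _×_; proj₁; proj₂)
open import Data.Sum using (_⊎_; inj₁; inj₂)
open import Function using (_∘_)
open import Relation.Nullary using (¬_; yes; no; contradiction)
open import Relation.Binary.PropositionalEquality
open import Algebra.Properties.CommutativeSemigroup +-commutativeSemigroup
  using (interchange; x∙yz≈y∙xz; x∙yz≈z∙xy)
open import Algebra.Properties.CommutativeMonoid.Sum +-0-commutativeMonoid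
  using (sum; sum-cong-≗; ∑-distrib-+; sum-remove; sum-init-last; sum-replicate-zero)

sumFin-sum : ∀ {n} (f : Fin n → ℕ) → sumFin f ≡ sum f
sumFin-sum {zero}  f = refl
sumFin-sum {suc n} f = cong (f zero +_) (sumFin-sum (f ∘ suc))

sumFin-cong : ∀ {n} {f g : Fin n → ℕ} → (∀ i → f i ≡ g i) → sumFin f ≡ sumFin g
sumFin-cong {f = f} {g} f≗g = begin
  sumFin f  ≡⟨ sumFin-sum f ⟩
  sum f     ≡⟨ sum-cong-≗ f≗g ⟩
  sum g     ≡⟨ sumFin-sum g ⟨
  sumFin g  ∎
  where open ≡-Reasoning

sumFin-+ : ∀ {n} (f g : Fin n → ℕ) → sumFin (λ i → f i + g i) ≡ sumFin f + sumFin g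
sumFin-+ f g = begin
  sumFin (λ i → f i + g i)  ≡⟨ sumFin-sum (λ i → f i + g i) ⟩
  sum (λ i → f i + g i)     ≡⟨ ∑-distrib-+ f g ⟩
  sum f + sum g             ≡⟨ cong₂ _+_ (sumFin-sum f) (sumFin-sum g) ⟨
  sumFin f + sumFin g       ∎
  where open ≡-Reasoning

sumFin-zero : ∀ {n} {f : Fin n → ℕ} → (∀ i → f i ≡ 0) → sumFin f ≡ 0
sumFin-zero {n} {f} f≗0 = begin
  sumFin f          ≡⟨ sumFin-sum f ⟩
  sum f             ≡⟨ sum-cong-≗ f≗0 ⟩
  sum {n} (λ _ → 0) ≡⟨ sum-replicate-zero n ⟩
  0                 ∎
  where open ≡-Reasoning

sumFin-single : ∀ {n} (f : Fin n → ℕ) p → (∀ q → q ≢ p → f q ≡ 0) → sumFin f ≡ f p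
sumFin-single {zero}  f ()
sumFin-single {suc n} f p vanish = begin
  sumFin f                  ≡⟨ sumFin-sum f ⟩
  sum f                     ≡⟨ sum-remove {i = p} f ⟩
  f p + sum (removeAt f p)  ≡⟨ cong (f p +_) (sum-cong-≗ (λ k → vanish _ (punchInᵢ≢i p k))) ⟩
  f p + sum {n} (λ _ → 0)   ≡⟨ cong (f p +_) (sum-replicate-zero n) ⟩
  f p + 0                   ≡⟨ +-identityʳ (f p) ⟩
  f p                       ∎
  where open ≡-Reasoning

pair≤sumFin : ∀ {n} (f : Fin n → ℕ) {p q} → p ≢ q → f p + f q ≤ sumFin f
pair≤sumFin {zero}  f {()}
pair≤sumFin {suc n} f {p} {q} p≢q = begin
  f p + f q                            ≡⟨ cong (λ i → f p + f i) (punchIn-punchOut p≢q) ⟨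
  f p + removeAt f p (punchOut p≢q)    ≤⟨ +-monoʳ-≤ (f p) (entry≤sum (removeAt f p) (punchOut p≢q)) ⟩
  f p + sum (removeAt f p)             ≡⟨ sum-remove {i = p} f ⟨
  sum f                                ≡⟨ sumFin-sum f ⟨
  sumFin f                             ∎
  where
  open ≤-Reasoning
  entry≤sum : ∀ {m} (g : Fin m → ℕ) i → g i ≤ sum g
  entry≤sum {suc m} g i = ≤-trans (m≤m+n (g i) _) (≤-reflexive (sym (sum-remove {i = i} g)))

sumFin-exchange₁₂ : ∀ {n} (f g : Fin (3 + n) → ℕ) →
  f 0F ≡ g 0F → f 1F + f 2F ≡ g 1F + g 2F → (∀ i → f (suc (suc (suc i))) ≡ g (suc (suc (suc i)))) →
  sumFin f ≡ sumFin g
sumFin-exchange₁₂ f g f₀≡g₀ f₁₂≡g₁₂ rest≗ = cong₂ _+_ f₀≡g₀ (begin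
  f 1F + (f 2F + sumFin f₃)  ≡⟨ +-assoc (f 1F) _ _ ⟨
  f 1F + f 2F + sumFin f₃    ≡⟨ cong₂ _+_ f₁₂≡g₁₂ (sumFin-cong rest≗) ⟩
  g 1F + g 2F + sumFin g₃    ≡⟨ +-assoc (g 1F) _ _ ⟩
  g 1F + (g 2F + sumFin g₃)  ∎)
  where
  open ≡-Reasoning
  f₃ g₃ : Fin _ → ℕ
  f₃ i = f (suc (suc (suc i)))
  g₃ i = g (suc (suc (suc i)))

Σ< : ℕ → (ℕ → ℕ) → ℕ
Σ< n g = sumFin {n} (λ i → g (toℕ i))

Σ<-snoc : ∀ n g → Σ< (suc n) g ≡ Σ< n g + g n
Σ<-snoc n g = begin
  Σ< (suc n) g                     ≡⟨ sumFin-sum h ⟩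
  sum h                            ≡⟨ sum-init-last h ⟩
  sum (h ∘ inject₁) + h (fromℕ n)  ≡⟨ cong₂ _+_ init≡ (cong g (toℕ-fromℕ n)) ⟩
  Σ< n g + g n                     ∎
  where
  open ≡-Reasoning
  h : Fin (suc n) → ℕ
  h i = g (toℕ i)
  init≡ : sum (h ∘ inject₁) ≡ Σ< n g
  init≡ = trans (sum-cong-≗ (λ (i : Fin n) → cong g (toℕ-inject₁ i)))
                (sym (sumFin-sum {n} (λ i → g (toℕ i))))

Σ<-rotate : ∀ n g → g n ≡ g 0 → Σ< n (g ∘ suc) ≡ Σ< n g
Σ<-rotate n g gn≡g0 = +-cancelˡ-≡ (g 0) _ _ (begin
  g 0 + Σ< n (g ∘ suc)  ≡⟨ Σ<-snoc n g ⟩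
  Σ< n g + g n          ≡⟨ cong (Σ< n g +_) gn≡g0 ⟩
  Σ< n g + g 0          ≡⟨ +-comm (Σ< n g) (g 0) ⟩
  g 0 + Σ< n g          ∎)
  where open ≡-Reasoning

Σ<-shift : ∀ n g → (∀ x → g (n + x) ≡ g x) → ∀ c → Σ< n (λ x → g (x + c)) ≡ Σ< n g
Σ<-shift n g periodic zero    = sumFin-cong {n} (λ i → cong g (+-identityʳ (toℕ i)))
Σ<-shift n g periodic (suc c) = begin
  Σ< n (λ x → g (x + suc c))  ≡⟨ sumFin-cong {n} (λ i → cong g (+-suc (toℕ i) c)) ⟩
  Σ< n (λ x → g (suc x + c))  ≡⟨ Σ<-rotate n (λ x → g (x + c)) (periodic c) ⟩
  Σ< n (λ x → g (x + c))      ≡⟨ Σ<-shift n g periodic c ⟩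
  Σ< n g                      ∎
  where open ≡-Reasoning

δ : ℕ → ℕ → ℕ
δ zero    zero    = 1
δ zero    (suc _) = 0
δ (suc _) zero    = 0
δ (suc a) (suc b) = δ a b

δ-refl : ∀ a → δ a a ≡ 1
δ-refl zero    = refl
δ-refl (suc a) = δ-refl a

δ-≢ : ∀ {a b} → a ≢ b → δ a b ≡ 0
δ-≢ {zero}  {zero}  a≢b = contradiction refl a≢b
δ-≢ {zero}  {suc b} a≢b = refl
δ-≢ {suc a} {zero}  a≢b = refl
δ-≢ {suc a} {suc b} a≢b = δ-≢ (a≢b ∘ cong suc)

δ-sym : ∀ a b → δ a b ≡ δ b a
δ-sym zero    zero    = refl
δ-sym zero    (suc b) = refl
δ-sym (suc a) zero    = refl
δ-sym (suc a) (suc b) = δ-sym a b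

sumFin-δ : ∀ {n a} → a < n → sumFin {n} (λ t → δ a (toℕ t)) ≡ 1
sumFin-δ {n} {a} a<n = begin
  sumFin {n} (λ t → δ a (toℕ t))  ≡⟨ sumFin-single {n} _ (fromℕ< a<n) vanish ⟩
  δ a (toℕ (fromℕ< a<n))          ≡⟨ cong (δ a) (toℕ-fromℕ< a<n) ⟩
  δ a a                           ≡⟨ δ-refl a ⟩
  1                               ∎
  where
  open ≡-Reasoning
  vanish : ∀ t → t ≢ fromℕ< a<n → δ a (toℕ t) ≡ 0
  vanish t t≢a = δ-≢ (λ a≡t → t≢a (toℕ-injective (trans (sym a≡t) (sym (toℕ-fromℕ< a<n)))))

Σ<-δ : ∀ {n s} → s < n → Σ< n (λ x → δ x s) ≡ 1
Σ<-δ {n} {s} s<n = trans (sumFin-cong {n} (λ t → δ-sym (toℕ t) s)) (sumFin-δ s<n)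

Within : ∀ {n} → Multiset n → Fin n → Fin n → Set
Within M a b = ∀ q → q ≢ a → q ≢ b → M q ≡ 0

within-δ : ∀ {n} {a b : Fin n} {v} → toℕ a ≡ v ⊎ toℕ b ≡ v → Within (λ q → δ v (toℕ q)) a b
within-δ (inj₁ a≡v) q q≢a q≢b = δ-≢ (λ v≡q → q≢a (toℕ-injective (sym (trans a≡v v≡q))))
within-δ (inj₂ b≡v) q q≢a q≢b = δ-≢ (λ v≡q → q≢b (toℕ-injective (sym (trans b≡v v≡q))))

within-+ : ∀ {n} {M M' : Multiset n} {a b} → Within M a b → Within M' a b →
  Within (λ q → M q + M' q) a b
within-+ w w' q q≢a q≢b = cong₂ _+_ (w q q≢a q≢b) (w' q q≢a q≢b)

within-copies : ∀ {n} k {L : Array n} {i j a b} → Within (L i j) a b →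
  Within (joinAll k (λ _ → L) i j) a b
within-copies zero    w q q≢a q≢b = refl
within-copies (suc k) w = within-+ w (within-copies k w)

unit-exclusive : ∀ {n} {f : Fin n → ℕ} {p q} → sumFin f ≡ 1 → 0 < f p → q ≢ p → f q ≡ 0
unit-exclusive {f = f} {p} {q} Σf≡1 fp>0 q≢p = n≤0⇒n≡0 (s≤s⁻¹ (begin
  1 + f q    ≤⟨ +-monoˡ-≤ (f q) fp>0 ⟩
  f p + f q  ≤⟨ pair≤sumFin f (q≢p ∘ sym) ⟩
  sumFin f   ≡⟨ Σf≡1 ⟩
  1          ∎))
  where open ≤-Reasoning

unit-forced : ∀ {n} {f : Fin n → ℕ} {a b} → sumFin f ≡ 1 → Within f a b → f a ≡ 0 → 0 < f b
unit-forced {f = f} {a} {b} Σf≡1 f⊆ab fa≡0 =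
  ≤-reflexive (trans (sym Σf≡1) (sumFin-single f b vanish))
  where
  vanish : ∀ q → q ≢ b → f q ≡ 0
  vanish q q≢b with q Fin.≟ a
  ... | yes refl = fa≡0
  ... | no  q≢a  = f⊆ab q q≢a q≢b

-- The trap: following σ through column c', row r and column c forces σ
-- into (r', c) as well as (r', c'), impossible in the row r'.
latin-trap : ∀ {n} {L : Array n} {r r' c c' σ τ ρ : Fin n} → IsLatin n L →
  r ≢ r' → c ≢ c' → Within (L r c') σ τ → Within (L r c) τ ρ → Within (L r' c) ρ σ →
  ¬ 0 < L r' c' σ
latin-trap {L = L} {r} {r'} {c} {c'} {σ} {τ} {ρ} lat r≢r' c≢c' rc'⊆στ rc⊆τρ r'c⊆ρσ σ∈r'c' =
  contradiction (unit-exclusive (rowCount r' σ) σ∈r'c' c≢c') (n>0⇒n≢0 σ∈r'c)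
  where
  open IsKLatin lat
  τ∈rc' : 0 < L r c' τ
  τ∈rc' = unit-forced (cellSize r c') rc'⊆στ (unit-exclusive (colCount c' σ) σ∈r'c' r≢r')
  ρ∈rc : 0 < L r c ρ
  ρ∈rc = unit-forced (cellSize r c) rc⊆τρ (unit-exclusive (rowCount r τ) τ∈rc' c≢c')
  σ∈r'c : 0 < L r' c σ
  σ∈r'c = unit-forced (cellSize r' c) r'c⊆ρσ (unit-exclusive (colCount c ρ) ρ∈rc (≢-sym r≢r'))

component≤ : ∀ {n} k (Ls : Fin k → Array n) t i j s → Ls t i j s ≤ joinAll k Ls i j s
component≤ (suc k) Ls zero    i j s = m≤m+n _ _
component≤ (suc k) Ls (suc t) i j s = ≤-trans (component≤ k (Ls ∘ suc) t i j s) (m≤n+m _ _)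

some-component : ∀ {n} k (Ls : Fin k → Array n) i j s →
  0 < joinAll k Ls i j s → Σ (Fin k) λ t → 0 < Ls t i j s
some-component (suc k) Ls i j s occ with Ls zero i j s in eq
... | suc _ = zero , subst (0 <_) (sym eq) (s≤s z≤n)
... | zero  with some-component k (Ls ∘ suc) i j s occ
...   | t , occ' = suc t , occ'

trap⇒not-separable : ∀ {k n} {A : Array n} {r r' c c' σ τ ρ : Fin n} →
  r ≢ r' → c ≢ c' → Within (A r c') σ τ → Within (A r c) τ ρ → Within (A r' c) ρ σ →
  0 < A r' c' σ → ¬ FullySeparable k n A
trap⇒not-separable {k} {A = A} {r' = r'} {c' = c'} {σ = σ}
  r≢r' c≢c' rc'⊆ rc⊆ r'c⊆ σ∈A (Ls , latin , A≡join)
  with some-component k Ls r' c' σ (subst (0 <_) (A≡join r' c' σ) σ∈A)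
... | t , σ∈Lt = latin-trap (latin t) r≢r' c≢c' (inherit rc'⊆) (inherit rc⊆) (inherit r'c⊆) σ∈Lt
  where
  inherit : ∀ {i j a b} → Within (A i j) a b → Within (Ls t i j) a b
  inherit {i} {j} w q q≢a q≢b = n≤0⇒n≡0
    (subst (Ls t i j q ≤_) (trans (sym (A≡join i j q)) (w q q≢a q≢b)) (component≤ k Ls t i j q))

join-latin : ∀ {a b n} {A B : Array n} → IsKLatin a n A → IsKLatin b n B →
  IsKLatin (a + b) n (join A B)
join-latin {n = n} LA LB = record
  { cellSize = λ i j → trans (sumFin-+ {n} _ _) (cong₂ _+_ (cellSize LA i j) (cellSize LB i j))
  ; rowCount = λ i s → trans (sumFin-+ {n} _ _) (cong₂ _+_ (rowCount LA i s) (rowCount LB i s))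
  ; colCount = λ j s → trans (sumFin-+ {n} _ _) (cong₂ _+_ (colCount LA j s) (colCount LB j s))
  }
  where open IsKLatin

copies-latin : ∀ {n} {L : Array n} m → IsLatin n L → IsKLatin m n (joinAll m (λ _ → L))
copies-latin {n} zero _ = record
  { cellSize = λ _ _ → sumFin-zero {n} (λ _ → refl)
  ; rowCount = λ _ _ → sumFin-zero {n} (λ _ → refl)
  ; colCount = λ _ _ → sumFin-zero {n} (λ _ → refl)
  }
copies-latin (suc m) lat = join-latin lat (copies-latin m lat)

module Cyclic (N : ℕ) .{{_ : NonZero N}} where

  sing : ℕ → Multiset N
  sing a s = δ (a % N) (toℕ s)

  pair : ℕ → ℕ → Multiset N
  pair a b s = sing a s + sing b s

  size-pair : ∀ a b → sumFin (pair a b) ≡ 2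
  size-pair a b = trans (sumFin-+ (sing a) (sing b))
    (cong₂ _+_ (sumFin-δ (m%n<n a N)) (sumFin-δ (m%n<n b N)))

  Σ<-cyclic : ∀ c {s} → s < N → Σ< N (λ x → δ ((x + c) % N) s) ≡ 1
  Σ<-cyclic c {s} s<N = begin
    Σ< N (λ x → δ ((x + c) % N) s)  ≡⟨ Σ<-shift N (λ x → δ (x % N) s) periodic c ⟩
    Σ< N (λ x → δ (x % N) s)        ≡⟨ sumFin-cong (λ t → cong (λ v → δ v s) (m<n⇒m%n≡m (toℕ<n t))) ⟩
    Σ< N (λ x → δ x s)              ≡⟨ Σ<-δ s<N ⟩
    1                               ∎
    where
    open ≡-Reasoning
    periodic : ∀ x → δ ((N + x) % N) s ≡ δ (x % N) s
    periodic x = cong (λ v → δ v s) (trans (cong (_% N) (+-comm N x)) ([m+n]%n≡m%n x N))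

  cyc : ℕ → Array N
  cyc c i j = sing (c + (toℕ i + toℕ j))

  cyc-latin : ∀ c → IsLatin N (cyc c)
  cyc-latin c = record
    { cellSize = λ i j → sumFin-δ (m%n<n _ N)
    ; rowCount = λ i s → trans
        (sumFin-cong {N} (λ j → cong (λ v → δ (v % N) (toℕ s)) (x∙yz≈z∙xy c (toℕ i) (toℕ j))))
        (Σ<-cyclic (c + toℕ i) (toℕ<n s))
    ; colCount = λ j s → trans
        (sumFin-cong {N} (λ i → cong (λ v → δ (v % N) (toℕ s)) (x∙yz≈y∙xz c (toℕ i) (toℕ j))))
        (Σ<-cyclic (c + toℕ j) (toℕ<n s))
    }

module Construction (m : ℕ) where

  N : ℕ
  N = 4 + m

  open Cyclic N

  -- Outside rows 1
  -- and 2, T is cyc 0 ∪ cyc 1; row 1 is cyc 0 ∪ cyc 2 and row 2 is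
  -- cyc 0 ∪ cyc 0, except in columns 1 and 2 where the cells are exchanged
  -- so that the columns keep the contents of cyc 0 ∪ cyc 1.
  entries : Fin N → Fin N → ℕ × ℕ
  entries 1F 1F = 2 , 3
  entries 1F 2F = 4 , 5
  entries 1F j  = 1 + toℕ j , 3 + toℕ j
  entries 2F 1F = 3 , 4
  entries 2F 2F = 3 , 4
  entries 2F j  = 2 + toℕ j , 2 + toℕ j
  entries i  j  = toℕ i + toℕ j , 1 + (toℕ i + toℕ j)

  T : Array N
  T i j = pair (proj₁ (entries i j)) (proj₂ (entries i j))

  base : Array N
  base = join (cyc 0) (cyc 1)

  base-latin : IsKLatin 2 N base
  base-latin = join-latin (cyc-latin 0) (cyc-latin 1)

  rearrange : ∀ a b c → (a + c) + (b + b) ≡ (a + b) + (b + c)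
  rearrange a b c = trans (interchange a c b b) (cong (a + b +_) (+-comm c b))

  column-exchange : ∀ j s → T 1F j s + T 2F j s ≡ base 1F j s + base 2F j s
  column-exchange 0F                  s = rearrange (sing 1 s) (sing 2 s) (sing 3 s)
  column-exchange 1F                  s = refl
  column-exchange 2F                  s = +-comm (T 1F 2F s) (T 2F 2F s)
  column-exchange j@(suc (suc (suc _))) s =
    rearrange (sing (1 + toℕ j) s) (sing (2 + toℕ j) s) (sing (3 + toℕ j) s)

  -- Rows 1 and 2 of T are rows of cyc 0 ∪ cyc 2 and cyc 0 ∪ cyc 0 with
  -- the symbols of columns 1 and 2 redistributed; all other rows and, by
  -- column-exchange, all columns have the contents of base.
  T-latin : IsKLatin 2 N T
  T-latin = record { cellSize = cellSize ; rowCount = rowCount ; colCount = colCount }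
    where
    cellSize : ∀ i j → sumFin (T i j) ≡ 2
    cellSize i j = size-pair (proj₁ (entries i j)) (proj₂ (entries i j))

    rowCount : ∀ i s → sumFin (λ j → T i j s) ≡ 2
    rowCount 0F s = IsKLatin.rowCount base-latin 0F s
    rowCount 1F s = trans
      (sumFin-exchange₁₂ (λ j → T 1F j s) (λ j → join (cyc 0) (cyc 2) 1F j s)
        refl (interchange (sing 2 s) (sing 3 s) (sing 4 s) (sing 5 s)) (λ _ → refl))
      (IsKLatin.rowCount (join-latin (cyc-latin 0) (cyc-latin 2)) 1F s)
    rowCount 2F s = trans
      (sumFin-exchange₁₂ (λ j → T 2F j s) (λ j → join (cyc 0) (cyc 0) 2F j s)
        refl (interchange (sing 3 s) (sing 4 s) (sing 3 s) (sing 4 s)) (λ _ → refl))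
      (IsKLatin.rowCount (join-latin (cyc-latin 0) (cyc-latin 0)) 2F s)
    rowCount i@(suc (suc (suc _))) s = IsKLatin.rowCount base-latin i s

    colCount : ∀ j s → sumFin (λ i → T i j s) ≡ 2
    colCount j s = trans
      (sumFin-exchange₁₂ (λ i → T i j s) (λ i → base i j s) refl (column-exchange j s) (λ _ → refl))
      (IsKLatin.colCount base-latin j s)

  -- For k ≥ 2 the square T ∪ (k - 2) copies of cyc 0; we write k = 2 + k₂.
  square : ℕ → Array N
  square k₂ = join T (joinAll k₂ (λ _ → cyc 0))

  square-latin : ∀ k₂ → IsKLatin (2 + k₂) N (square k₂)
  square-latin k₂ = join-latin T-latin (copies-latin k₂ (cyc-latin 0))

  -- The trap of square k₂: rows r = 1, r' = 0, columns c = 1, c' = 0 and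
  -- symbols σ = 1, τ = 3, ρ = 2.  The cells of T and of cyc 0 involved are
  -- T(1,0) = {1,3}, T(1,1) = {2,3}, T(0,1) = {1,2}, T(0,0) = {0,1} and
  -- cyc 0 (1,0) = cyc 0 (0,1) = {1}, cyc 0 (1,1) = {2}.
  square-not-separable : ∀ k₂ k → ¬ FullySeparable k N (square k₂)
  square-not-separable k₂ k = trap⇒not-separable {r = 1F} {0F} {1F} {0F} {1F} {3F} {2F}
    (λ ()) (λ ())
    (within-square (within-+ (within-δ (inj₁ refl)) (within-δ (inj₂ refl))) (within-δ (inj₁ refl)))
    (within-square (within-+ (within-δ (inj₂ refl)) (within-δ (inj₁ refl))) (within-δ (inj₂ refl)))
    (within-square (within-+ (within-δ (inj₂ refl)) (within-δ (inj₁ refl))) (within-δ (inj₂ refl)))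
    (s≤s z≤n)
    where
    within-square : ∀ {i j a b} → Within (T i j) a b → Within (cyc 0 i j) a b →
      Within (square k₂ i j) a b
    within-square wT wC = within-+ wT (within-copies k₂ wC)

not-separable-exists : ∀ k n → 2 ≤ k → 4 ≤ n →
  Σ (Array n) λ A → IsKLatin k n A × ¬ FullySeparable k n A
not-separable-exists (suc (suc k₂)) (suc (suc (suc (suc m)))) (s≤s (s≤s z≤n)) (s≤s (s≤s (s≤s (s≤s z≤n)))) =
  square k₂ , square-latin k₂ , square-not-separable k₂ (2 + k₂)
  where open Construction m

mainTheorem8 : (k n : ℕ) → 2 ≤ k → 2 * k + 1 ≤ n →
    Σ (Array n) λ A → IsKLatin k n A × ¬ FullySeparable k n A
mainTheorem8 k n 2≤k 2k+1≤n = not-separable-exists k n 2≤k 4≤n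
  where
  4≤n : 4 ≤ n
  4≤n = ≤-trans (≤-trans (*-monoʳ-≤ 2 2≤k) (m≤m+n (2 * k) 1)) 2k+1≤n
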